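{- Let $\mathbb{C}_1,\dots,\mathbb{C}_n$ and $\mathbb{D}$ be comonads on categories $\mathcal{C}_1,\dots,\mathcal{C}_n$ and $\mathcal{D}$ respectively, and let $H\colon \mathcal{C}_1\times\dots\times\mathcal{C}_n\to\mathcal{D}$ be a functor. Suppose that for every $A_1\in\mathcal{C}_1,\dots,A_n\in\mathcal{C}_n$ there exists a morphism $\kappa_{A_1,\dots,A_n}\colon \mathbb{D}(H(A_1,\dots,A_n))\to H(\mathbb{C}_1(A_1),\dots,\mathbb{C}_n(A_n))$ in $\mathcal{D}$. Then for all objects $A_i,B_i\in\mathcal{C}_i$ ($1\le i\le n$): if $A_i\rightarrow_{\mathbb{C}_i} B_i$ for all $i$, then $H(A_1,\dots,A_n)\rightarrow_{\mathbb{D}} H(B_1,\dots,B_n)$. The same holds with $\rightarrow$ replaced by $\rightleftarrows$ throughout.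
   Context: For a comonad $\mathbb{C}$ on a category $\mathcal{C}$ and objects $A,B$, write $A\rightarrow_{\mathbb{C}} B$ if there exists a morphism $\mathbb{C}(A)\to B$ in $\mathcal{C}$, and $A\rightleftarrows_{\mathbb{C}} B$ if both $A\rightarrow_{\mathbb{C}} B$ and $B\rightarrow_{\mathbb{C}} A$. No naturality of $\kappa$ is assumed. -}

module Defs where

open import Level using (Level; _⊔_; suc)
open import Data.Nat using (ℕ)
open import Data.Fin using (Fin)
open import Data.Product using (_×_; ∃)
open import Relation.Binary using (Rel; IsEquivalence)

record Category (o ℓ e : Level) : Set (suc (o ⊔ ℓ ⊔ e)) where
  infixr 9 _∘_
  infix  4 _≈_
  field
    Obj   : Set o
    Hom   : Obj → Obj → Set ℓ
    _≈_   : ∀ {A B} → Rel (Hom A B) e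
    id    : ∀ {A} → Hom A A
    _∘_   : ∀ {A B C} → Hom B C → Hom A B → Hom A C
    equiv     : ∀ {A B} → IsEquivalence (_≈_ {A} {B})
    ∘-resp-≈  : ∀ {A B C} {f h : Hom B C} {g i : Hom A B} →
                f ≈ h → g ≈ i → f ∘ g ≈ h ∘ i
    assoc     : ∀ {A B C D} {f : Hom A B} {g : Hom B C} {h : Hom C D} →
                (h ∘ g) ∘ f ≈ h ∘ (g ∘ f)
    identityˡ : ∀ {A B} {f : Hom A B} → id ∘ f ≈ f
    identityʳ : ∀ {A B} {f : Hom A B} → f ∘ id ≈ f

open Category

record Functor {o ℓ e o′ ℓ′ e′} (C : Category o ℓ e) (D : Category o′ ℓ′ e′)
       : Set (o ⊔ ℓ ⊔ e ⊔ o′ ⊔ ℓ′ ⊔ e′) where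
  field
    F₀ : Obj C → Obj D
    F₁ : ∀ {A B} → Hom C A B → Hom D (F₀ A) (F₀ B)
    identity     : ∀ {A} → _≈_ D (F₁ (id C {A})) (id D)
    homomorphism : ∀ {X Y Z} {f : Hom C X Y} {g : Hom C Y Z} →
                   _≈_ D (F₁ (_∘_ C g f)) (_∘_ D (F₁ g) (F₁ f))
    F-resp-≈     : ∀ {A B} {f g : Hom C A B} → _≈_ C f g → _≈_ D (F₁ f) (F₁ g)

record Comonad {o ℓ e} (C : Category o ℓ e) : Set (o ⊔ ℓ ⊔ e) where
  field
    F : Functor C C
  open Functor F
  field
    ε : ∀ A → Hom C (F₀ A) A
    δ : ∀ A → Hom C (F₀ A) (F₀ (F₀ A))
    ε-natural : ∀ {A B} (f : Hom C A B) →
                _≈_ C (_∘_ C f (ε A)) (_∘_ C (ε B) (F₁ f))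
    δ-natural : ∀ {A B} (f : Hom C A B) →
                _≈_ C (_∘_ C (F₁ (F₁ f)) (δ A)) (_∘_ C (δ B) (F₁ f))
    counitˡ : ∀ {A} → _≈_ C (_∘_ C (ε (F₀ A)) (δ A)) (id C)
    counitʳ : ∀ {A} → _≈_ C (_∘_ C (F₁ (ε A)) (δ A)) (id C)
    coassoc : ∀ {A} → _≈_ C (_∘_ C (δ (F₀ A)) (δ A)) (_∘_ C (F₁ (δ A)) (δ A))

_⟨_⟩ : ∀ {o ℓ e} {C : Category o ℓ e} → Comonad C → Obj C → Obj C
M ⟨ A ⟩ = Functor.F₀ (Comonad.F M) A

_→[_]_ : ∀ {o ℓ e} {C : Category o ℓ e} → Obj C → Comonad C → Obj C → Set ℓ
_→[_]_ {C = C} A M B = Hom C (M ⟨ A ⟩) B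

_⇄[_]_ : ∀ {o ℓ e} {C : Category o ℓ e} → Obj C → Comonad C → Obj C → Set ℓ
A ⇄[ M ] B = (A →[ M ] B) × (B →[ M ] A)

Π-Cat : ∀ {o ℓ e} (n : ℕ) → (Fin n → Category o ℓ e) → Category o ℓ e
Π-Cat n C = record
  { Obj = (i : Fin n) → Obj (C i)
  ; Hom = λ A B → (i : Fin n) → Hom (C i) (A i) (B i)
  ; _≈_ = λ f g → (i : Fin n) → _≈_ (C i) (f i) (g i)
  ; id = λ i → id (C i)
  ; _∘_ = λ f g i → _∘_ (C i) (f i) (g i)
  ; equiv = record
      { refl  = λ i → IsEquivalence.refl (equiv (C i))
      ; sym   = λ p i → IsEquivalence.sym (equiv (C i)) (p i)
      ; trans = λ p q i → IsEquivalence.trans (equiv (C i)) (p i) (q i) }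
  ; ∘-resp-≈ = λ p q i → ∘-resp-≈ (C i) (p i) (q i)
  ; assoc = λ i → assoc (C i)
  ; identityˡ = λ i → identityˡ (C i)
  ; identityʳ = λ i → identityʳ (C i)
  }

module Submission where

open import Defs
open import Data.Nat using (ℕ)
open import Data.Fin using (Fin)
open import Data.Product using (_×_; _,_; proj₁; proj₂)

-- Regard C₁ × ⋯ × Cₙ with the pointwise comonad, which reduces the
-- theorem to n = 1. There a map ℂ(A) → B is pushed through H and precomposed
-- with κ_A.

module _ {o ℓ e o′ ℓ′ e′} {C : Category o ℓ e} {D : Category o′ ℓ′ e′}
         (ℂ : Comonad C) (𝔻 : Comonad D) (H : Functor C D)
         (κ : ∀ A → Category.Hom D (𝔻 ⟨ Functor.F₀ H A ⟩) (Functor.F₀ H (ℂ ⟨ A ⟩)))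
         where

  open Functor H using (F₀; F₁)

  →-map : ∀ {A B} → A →[ ℂ ] B → F₀ A →[ 𝔻 ] F₀ B
  →-map {A} f = Category._∘_ D (F₁ f) (κ A)

  ⇄-map : ∀ {A B} → A ⇄[ ℂ ] B → F₀ A ⇄[ 𝔻 ] F₀ B
  ⇄-map (f , g) = →-map f , →-map g

Π-Comonad : ∀ {o ℓ e} (n : ℕ) (C : Fin n → Category o ℓ e) →
            ((i : Fin n) → Comonad (C i)) → Comonad (Π-Cat n C)
Π-Comonad n C ℂ = record
  { F = record
      { F₀ = λ A i → ℂ i ⟨ A i ⟩
      ; F₁ = λ f i → F₁ i (f i)
      ; identity = λ i → identity i
      ; homomorphism = λ i → homomorphism i
      ; F-resp-≈ = λ p i → F-resp-≈ i (p i)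
      }
  ; ε = λ A i → ε i (A i)
  ; δ = λ A i → δ i (A i)
  ; ε-natural = λ f i → ε-natural i (f i)
  ; δ-natural = λ f i → δ-natural i (f i)
  ; counitˡ = λ i → counitˡ i
  ; counitʳ = λ i → counitʳ i
  ; coassoc = λ i → coassoc i
  }
  where
  open module ℂᵢ (i : Fin n) = Comonad (ℂ i)
  open module Fᵢ (i : Fin n) = Functor (F i)

Π-⇄ : ∀ {o ℓ e} {n : ℕ} {C : Fin n → Category o ℓ e} (ℂ : (i : Fin n) → Comonad (C i))
        {A B : (i : Fin n) → Category.Obj (C i)} →
        ((i : Fin n) → A i ⇄[ ℂ i ] B i) → A ⇄[ Π-Comonad n C ℂ ] B
Π-⇄ ℂ p = (λ i → proj₁ (p i)) , (λ i → proj₂ (p i))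

theorem2 : ∀ {o ℓ e o′ ℓ′ e′} (n : ℕ)
    (C : Fin n → Category o ℓ e) (ℂ : (i : Fin n) → Comonad (C i))
    (D : Category o′ ℓ′ e′) (𝔻 : Comonad D)
    (H : Functor (Π-Cat n C) D)
    (κ : (A : (i : Fin n) → Category.Obj (C i)) →
    Category.Hom D (𝔻 ⟨ Functor.F₀ H A ⟩) (Functor.F₀ H (λ i → ℂ i ⟨ A i ⟩))) →
    ((A B : (i : Fin n) → Category.Obj (C i)) →
    ((i : Fin n) → A i →[ ℂ i ] B i) → Functor.F₀ H A →[ 𝔻 ] Functor.F₀ H B)
    × ((A B : (i : Fin n) → Category.Obj (C i)) →
    ((i : Fin n) → A i ⇄[ ℂ i ] B i) → Functor.F₀ H A ⇄[ 𝔻 ] Functor.F₀ H B)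
theorem2 n C ℂ D 𝔻 H κ =
    (λ A B f → →-map (Π-Comonad n C ℂ) 𝔻 H κ f)
  , (λ A B p → ⇄-map (Π-Comonad n C ℂ) 𝔻 H κ (Π-⇄ ℂ p))
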